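{- Let $a \geq 2$ be an integer and define rational numbers $G_{n,a}$ ($n \in \mathbb{N}$) by the formal power series identity $$\frac{a t}{e^{(a-1)t} + e^{(a-2)t} + \dots + e^{t} + 1} = \sum_{n=0}^{\infty} G_{n,a} \frac{t^n}{n!}.$$ Then for every positive integer $n$, $G_{n,a}$ is an integer.
   Context: The identity is understood in the ring $\mathbb{Q}[[t]]$ of formal power series with rational coefficients. For $a=2$ the $G_{n,2}$ are the classical Genocchi numbers. -}

module Defs where

open import Data.Nat as ℕ using (ℕ; zero; suc; _∸_; _!)
open import Data.Nat.Properties using (_!≢0)
open import Data.Integer using (ℤ; +_)
open import Data.Rational using (ℚ; _/_; 0ℚ; _+_; _*_)

-- Formal power series over ℚ, given by their (ordinary) coefficient sequence:
-- f represents  Σ_n f n · tⁿ.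
PowerSeries : Set
PowerSeries = ℕ → ℚ

sumBelow : ℕ → (ℕ → ℚ) → ℚ
sumBelow zero    f = 0ℚ
sumBelow (suc n) f = sumBelow n f + f n

_⊕_ : PowerSeries → PowerSeries → PowerSeries
(f ⊕ g) n = f n + g n

_⊛_ : PowerSeries → PowerSeries → PowerSeries
(f ⊛ g) n = sumBelow (suc n) (λ k → f k * g (n ∸ k))

expSeries : ℕ → PowerSeries
expSeries j n = (+ (j ℕ.^ n) / (n !)) {{n !≢0}}

expSumSeries : ℕ → PowerSeries
expSumSeries a n = sumBelow a (λ j → expSeries j n)

atSeries : ℕ → PowerSeries
atSeries a (suc zero) = + a / 1
atSeries a _          = 0ℚ

egf : (ℕ → ℚ) → PowerSeries
egf G n = G n * (+ 1 / (n !)) {{n !≢0}}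

-- G is the sequence (G_{n,a})_n defined by
--   a t / (e^{(a-1)t} + ... + e^t + 1) = Σ_n G_{n,a} tⁿ/n!,
-- i.e. (since the denominator has constant term a ≠ 0, hence is invertible in ℚ[[t]])
--   a t = (Σ_n G_{n,a} tⁿ/n!) · (e^{(a-1)t} + ... + e^t + 1).
IsGenocchiSeq : ℕ → (ℕ → ℚ) → Set
IsGenocchiSeq a G = ∀ n → atSeries a n ≡ (egf G ⊛ expSumSeries a) n
  where open import Relation.Binary.PropositionalEquality using (_≡_)

IsInteger : ℚ → Set
IsInteger q = Σ ℤ (λ z → q ≡ z / 1)
  where open import Data.Product using (Σ)
        open import Relation.Binary.PropositionalEquality using (_≡_)

{-# OPTIONS --safe #-}
-- Put u = e^t − 1 and s = e^((a−1)t) + … + e^t + 1, so that u s = e^(at) − 1. Expanding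
-- log (1 + x) = Σₖ (−1)ᵏ k! xᵏ⁺¹/(k+1)! at x = u s gives
--   a t / s = Σₖ (−1)ᵏ k! · u^(k+1)/(k+1)! · sᵏ.
-- Both u^(k+1)/(k+1)! = Σₙ S(n, k+1) tⁿ/n! and s have integral coefficients with respect to
-- the basis tⁿ/n!, and products preserve this, so a t / s has integral coefficients G_{n,a}.
-- The computation runs over integer sequences multiplied as exponential generating functions;
-- it is transported to ℚ[[t]] at the end, where a t / s is unique since s(0) = a ≠ 0.
module Submission where

open import Defs
open import Data.Nat using (ℕ; _≤_)
open import Data.Rational using (ℚ)

open import Data.Nat as ℕ using (zero; suc; z≤n; s≤s; _!; _∸_)
import Data.Nat.Properties as ℕ
open import Data.Nat.Properties using (_!≢0)
open import Data.Integer as ℤ using (ℤ; +_; -_; _+_; _*_; _-_; _^_)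
import Data.Integer.Properties as ℤ
open import Data.Integer.Tactic.RingSolver using (solve-∀)
open import Data.Rational as Q using (1ℚ; toℚᵘ)
import Data.Rational.Properties as Q
open import Data.Rational.Unnormalised as ℚᵘ using (mkℚᵘ; *≡*)
import Data.Rational.Unnormalised.Properties as ℚᵘ
open import Data.Rational.Solver using (module +-*-Solver)
open import Algebra.Properties.Group Q.+-0-group using (∙-cancelˡ)
open import Data.Product using (_,_)
open import Data.Sum using (inj₁; inj₂)
open import Function using (_∘_)
open import Relation.Binary.PropositionalEquality

-- An integer sequence f stands for the exponential generating function Σ f n tⁿ/n!;
-- ∂ is d/dt, and the product is determined by the Leibniz rule.
Series : Set
Series = ℕ → ℤ

∂ : Series → Series
∂ f n = f (suc n)

infixr 8 _·_
infixl 7 _⊙_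
infixl 6 _⊞_

_⊙_ : Series → Series → Series
(f ⊙ g) zero    = f 0 * g 0
(f ⊙ g) (suc n) = (∂ f ⊙ g) n + (f ⊙ ∂ g) n

_⊞_ : Series → Series → Series
(f ⊞ g) n = f n + g n

_·_ : ℤ → Series → Series
(c · f) n = c * f n

0ˢ : Series
0ˢ _ = + 0

1ˢ : Series
1ˢ zero    = + 1
1ˢ (suc n) = + 0

∂-cong : ∀ {f g} → f ≗ g → ∂ f ≗ ∂ g
∂-cong f≗g n = f≗g (suc n)

⊙-cong : ∀ {f f′ g g′} → f ≗ f′ → g ≗ g′ → f ⊙ g ≗ f′ ⊙ g′
⊙-cong f≗f′ g≗g′ zero    = cong₂ _*_ (f≗f′ 0) (g≗g′ 0)
⊙-cong f≗f′ g≗g′ (suc n) =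
  cong₂ _+_ (⊙-cong (∂-cong f≗f′) g≗g′ n) (⊙-cong f≗f′ (∂-cong g≗g′) n)

⊙-comm : ∀ f g → f ⊙ g ≗ g ⊙ f
⊙-comm f g zero    = ℤ.*-comm (f 0) (g 0)
⊙-comm f g (suc n) =
  trans (cong₂ _+_ (⊙-comm (∂ f) g n) (⊙-comm f (∂ g) n))
        (ℤ.+-comm ((g ⊙ ∂ f) n) ((∂ g ⊙ f) n))

⊙-zeroˡ : ∀ g → 0ˢ ⊙ g ≗ 0ˢ
⊙-zeroˡ g zero    = refl
⊙-zeroˡ g (suc n) = cong₂ _+_ (⊙-zeroˡ g n) (⊙-zeroˡ (∂ g) n)

⊙-zeroʳ : ∀ f → f ⊙ 0ˢ ≗ 0ˢ
⊙-zeroʳ f n = trans (⊙-comm f 0ˢ n) (⊙-zeroˡ f n)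

⊙-identityˡ : ∀ f → 1ˢ ⊙ f ≗ f
⊙-identityˡ f zero    = ℤ.*-identityˡ (f 0)
⊙-identityˡ f (suc n) =
  trans (cong₂ _+_ (⊙-zeroˡ f n) (⊙-identityˡ (∂ f) n))
        (ℤ.+-identityˡ (f (suc n)))

⊙-identityʳ : ∀ f → f ⊙ 1ˢ ≗ f
⊙-identityʳ f n = trans (⊙-comm f 1ˢ n) (⊙-identityˡ f n)

⊙-distribʳ : ∀ f g h → (f ⊞ g) ⊙ h ≗ f ⊙ h ⊞ g ⊙ h
⊙-distribʳ f g h zero    = ℤ.*-distribʳ-+ (h 0) (f 0) (g 0)
⊙-distribʳ f g h (suc n) =
  trans (cong₂ _+_ (⊙-distribʳ (∂ f) (∂ g) h n) (⊙-distribʳ f g (∂ h) n))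
        (interchange ((∂ f ⊙ h) n) ((∂ g ⊙ h) n) ((f ⊙ ∂ h) n) ((g ⊙ ∂ h) n))
  where
  interchange : ∀ (a b c d : ℤ) → (a + b) + (c + d) ≡ (a + c) + (b + d)
  interchange = solve-∀

⊙-distribˡ : ∀ f g h → f ⊙ (g ⊞ h) ≗ f ⊙ g ⊞ f ⊙ h
⊙-distribˡ f g h n =
  trans (⊙-comm f (g ⊞ h) n)
  (trans (⊙-distribʳ g h f n) (cong₂ _+_ (⊙-comm g f n) (⊙-comm h f n)))

·-⊙ : ∀ c f g → (c · f) ⊙ g ≗ c · (f ⊙ g)
·-⊙ c f g zero    = ℤ.*-assoc c (f 0) (g 0)
·-⊙ c f g (suc n) =
  trans (cong₂ _+_ (·-⊙ c (∂ f) g n) (·-⊙ c f (∂ g) n))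
        (sym (ℤ.*-distribˡ-+ c ((∂ f ⊙ g) n) ((f ⊙ ∂ g) n)))

⊙-· : ∀ c f g → f ⊙ (c · g) ≗ c · (f ⊙ g)
⊙-· c f g n =
  trans (⊙-comm f (c · g) n) (trans (·-⊙ c g f n) (cong (c *_) (⊙-comm g f n)))

⊙-assoc : ∀ f g h → (f ⊙ g) ⊙ h ≗ f ⊙ (g ⊙ h)
⊙-assoc f g h zero    = ℤ.*-assoc (f 0) (g 0) (h 0)
⊙-assoc f g h (suc n) = begin
  (∂ (f ⊙ g) ⊙ h) n + ((f ⊙ g) ⊙ ∂ h) n
    ≡⟨ cong₂ _+_ (⊙-distribʳ (∂ f ⊙ g) (f ⊙ ∂ g) h n) (⊙-assoc f g (∂ h) n) ⟩
  ((∂ f ⊙ g) ⊙ h) n + ((f ⊙ ∂ g) ⊙ h) n + (f ⊙ (g ⊙ ∂ h)) n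
    ≡⟨ cong (_+ (f ⊙ (g ⊙ ∂ h)) n) (cong₂ _+_ (⊙-assoc (∂ f) g h n) (⊙-assoc f (∂ g) h n)) ⟩
  (∂ f ⊙ (g ⊙ h)) n + (f ⊙ (∂ g ⊙ h)) n + (f ⊙ (g ⊙ ∂ h)) n
    ≡⟨ ℤ.+-assoc ((∂ f ⊙ (g ⊙ h)) n) _ _ ⟩
  (∂ f ⊙ (g ⊙ h)) n + ((f ⊙ (∂ g ⊙ h)) n + (f ⊙ (g ⊙ ∂ h)) n)
    ≡⟨ cong (_+_ ((∂ f ⊙ (g ⊙ h)) n)) (sym (⊙-distribˡ f (∂ g ⊙ h) (g ⊙ ∂ h) n)) ⟩
  (∂ f ⊙ (g ⊙ h)) n + (f ⊙ ∂ (g ⊙ h)) n ∎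
  where open ≡-Reasoning

sumℤ : ℕ → (ℕ → ℤ) → ℤ
sumℤ zero    f = + 0
sumℤ (suc m) f = sumℤ m f + f m

Σˢ : ℕ → (ℕ → Series) → Series
Σˢ m h n = sumℤ m (λ k → h k n)

sumℤ-cong : ∀ m {f g} → f ≗ g → sumℤ m f ≡ sumℤ m g
sumℤ-cong zero    f≗g = refl
sumℤ-cong (suc m) f≗g = cong₂ _+_ (sumℤ-cong m f≗g) (f≗g m)

sumℤ-*ˡ : ∀ m x (f : ℕ → ℤ) → sumℤ m (λ k → x * f k) ≡ x * sumℤ m f
sumℤ-*ˡ zero    x f = sym (ℤ.*-zeroʳ x)
sumℤ-*ˡ (suc m) x f =
  trans (cong (_+ x * f m) (sumℤ-*ˡ m x f)) (sym (ℤ.*-distribˡ-+ x (sumℤ m f) (f m)))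

sumℤ-telescope : ∀ m (F : ℕ → ℤ) → sumℤ m (λ k → F (suc k) - F k) ≡ F m - F 0
sumℤ-telescope zero    F = sym (ℤ.+-inverseʳ (F 0))
sumℤ-telescope (suc m) F =
  trans (cong (_+ (F (suc m) - F m)) (sumℤ-telescope m F)) (collapse (F (suc m)) (F m) (F 0))
  where
  collapse : ∀ (x y z : ℤ) → (y - z) + (x - y) ≡ x - z
  collapse = solve-∀

sumℤ-telescope′ : ∀ m (F : ℕ → ℤ) → sumℤ m (λ k → F k - F (suc k)) ≡ F 0 - F m
sumℤ-telescope′ zero    F = sym (ℤ.+-inverseʳ (F 0))
sumℤ-telescope′ (suc m) F =
  trans (cong (_+ (F m - F (suc m))) (sumℤ-telescope′ m F)) (collapse (F (suc m)) (F m) (F 0))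
  where
  collapse : ∀ (x y z : ℤ) → (z - y) + (y - x) ≡ z - x
  collapse = solve-∀

⊙-sumˡ : ∀ m h g → Σˢ m h ⊙ g ≗ Σˢ m (λ k → h k ⊙ g)
⊙-sumˡ zero    h g n = ⊙-zeroˡ g n
⊙-sumˡ (suc m) h g n =
  trans (⊙-distribʳ (Σˢ m h) (h m) g n) (cong (_+ (h m ⊙ g) n) (⊙-sumˡ m h g n))

⊙-sumʳ : ∀ m f h → f ⊙ Σˢ m h ≗ Σˢ m (λ k → f ⊙ h k)
⊙-sumʳ m f h n =
  trans (⊙-comm f (Σˢ m h) n)
  (trans (⊙-sumˡ m h f n) (sumℤ-cong m (λ k → ⊙-comm (h k) f n)))

⊙-congˡ-upTo : ∀ {f f′} g n → (∀ i → i ℕ.≤ n → f i ≡ f′ i) → (f ⊙ g) n ≡ (f′ ⊙ g) n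
⊙-congˡ-upTo g zero    f≡f′ = cong (_* g 0) (f≡f′ 0 z≤n)
⊙-congˡ-upTo g (suc n) f≡f′ =
  cong₂ _+_ (⊙-congˡ-upTo g n (λ i i≤n → f≡f′ (suc i) (s≤s i≤n)))
            (⊙-congˡ-upTo (∂ g) n (λ i i≤n → f≡f′ i (ℕ.m≤n⇒m≤1+n i≤n)))

⊙-vanishes-below : ∀ {f} g j → (∀ i → i ℕ.< j → f i ≡ + 0) → ∀ n → n ℕ.< j → (f ⊙ g) n ≡ + 0
⊙-vanishes-below g (suc j) f<j≡0 zero    _         =
  trans (cong (_* g 0) (f<j≡0 0 (s≤s z≤n))) (ℤ.*-zeroˡ (g 0))
⊙-vanishes-below g (suc j) f<j≡0 (suc n) (s≤s n<j) =
  cong₂ _+_ (⊙-vanishes-below g j (λ i i<j → f<j≡0 (suc i) (s≤s i<j)) n n<j)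
            (⊙-vanishes-below (∂ g) (suc j) f<j≡0 n (ℕ.m<n⇒m<1+n n<j))

exp : ℤ → Series
exp c n = c ^ n

exp-+ : ∀ c d → exp c ⊙ exp d ≗ exp (c + d)
exp-+ c d zero    = refl
exp-+ c d (suc n) =
  trans (cong₂ _+_ (trans (·-⊙ c (exp c) (exp d) n) (cong (c *_) (exp-+ c d n)))
                   (trans (⊙-· d (exp c) (exp d) n) (cong (d *_) (exp-+ c d n))))
        (sym (ℤ.*-distribʳ-+ ((c + d) ^ n) c d))

exp-0 : exp (+ 0) ≗ 1ˢ
exp-0 zero    = refl
exp-0 (suc n) = refl

expm1 : Series
expm1 zero    = + 0
expm1 (suc n) = + 1

expm1≗exp-1ˢ : expm1 ≗ exp (+ 1) ⊞ (- + 1) · 1ˢ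
expm1≗exp-1ˢ zero    = refl
expm1≗exp-1ˢ (suc n) = sym (cong (_+ + 0) (ℤ.^-zeroˡ (suc n)))

expm1⊙exp : ∀ c → expm1 ⊙ exp c ≗ λ n → exp (+ 1 + c) n - exp c n
expm1⊙exp c n = begin
  (expm1 ⊙ exp c) n
    ≡⟨ ⊙-cong expm1≗exp-1ˢ (λ _ → refl) n ⟩
  ((exp (+ 1) ⊞ (- + 1) · 1ˢ) ⊙ exp c) n
    ≡⟨ ⊙-distribʳ (exp (+ 1)) ((- + 1) · 1ˢ) (exp c) n ⟩
  (exp (+ 1) ⊙ exp c) n + ((- + 1) · 1ˢ ⊙ exp c) n
    ≡⟨ cong₂ _+_ (exp-+ (+ 1) c n) (·-⊙ (- + 1) 1ˢ (exp c) n) ⟩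
  exp (+ 1 + c) n + (- + 1) * (1ˢ ⊙ exp c) n
    ≡⟨ cong (λ x → exp (+ 1 + c) n + (- + 1) * x) (⊙-identityˡ (exp c) n) ⟩
  exp (+ 1 + c) n + (- + 1) * exp c n
    ≡⟨ cong (_+_ (exp (+ 1 + c) n)) (ℤ.-1*i≡-i (exp c n)) ⟩
  exp (+ 1 + c) n - exp c n ∎
  where open ≡-Reasoning

⊙-rearrange : ∀ f g h k → (f ⊙ g) ⊙ (h ⊙ k) ≗ (g ⊙ h) ⊙ (f ⊙ k)
⊙-rearrange f g h k n = begin
  ((f ⊙ g) ⊙ (h ⊙ k)) n  ≡⟨ ⊙-assoc f g (h ⊙ k) n ⟩
  (f ⊙ (g ⊙ (h ⊙ k))) n  ≡⟨ ⊙-comm f (g ⊙ (h ⊙ k)) n ⟩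
  ((g ⊙ (h ⊙ k)) ⊙ f) n  ≡⟨ ⊙-assoc g (h ⊙ k) f n ⟩
  (g ⊙ ((h ⊙ k) ⊙ f)) n  ≡⟨ ⊙-cong (λ _ → refl) (⊙-assoc h k f) n ⟩
  (g ⊙ (h ⊙ (k ⊙ f))) n  ≡⟨ ⊙-assoc g h (k ⊙ f) n ⟨
  ((g ⊙ h) ⊙ (k ⊙ f)) n  ≡⟨ ⊙-cong (λ _ → refl) (⊙-comm k f) n ⟩
  ((g ⊙ h) ⊙ (f ⊙ k)) n  ∎
  where open ≡-Reasoning

infixr 8 _^ˢ_

_^ˢ_ : Series → ℕ → Series
f ^ˢ zero  = 1ˢ
f ^ˢ suc k = f ^ˢ k ⊙ f

-- Stirling numbers of the second kind: stirling j is the series (e^t − 1)^j / j!.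
S₂ : ℕ → ℕ → ℤ
S₂ zero    zero    = + 1
S₂ zero    (suc j) = + 0
S₂ (suc n) zero    = + 0
S₂ (suc n) (suc j) = + suc j * S₂ n (suc j) + S₂ n j

stirling : ℕ → Series
stirling j n = S₂ n j

S₂-vanish : ∀ {n j} → n ℕ.< j → S₂ n j ≡ + 0
S₂-vanish {zero}  {suc j} _         = refl
S₂-vanish {suc n} {suc j} (s≤s n<j) =
  cong₂ _+_ (trans (cong (+ suc j *_) (S₂-vanish (ℕ.m<n⇒m<1+n n<j))) (ℤ.*-zeroʳ (+ suc j)))
            (S₂-vanish n<j)

mutual
  expm1⊙stirling : ∀ j → expm1 ⊙ stirling j ≗ (+ suc j) · stirling (suc j)
  expm1⊙stirling j zero    = sym (ℤ.*-zeroʳ (+ suc j))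
  expm1⊙stirling j (suc n) = begin
    (∂ expm1 ⊙ stirling j) n + (expm1 ⊙ ∂ (stirling j)) n
      ≡⟨ cong (_+ (expm1 ⊙ ∂ (stirling j)) n)
              (trans (⊙-cong ∂expm1 (λ _ → refl) n) (⊙-distribʳ expm1 1ˢ (stirling j) n)) ⟩
    (expm1 ⊙ stirling j) n + (1ˢ ⊙ stirling j) n + (expm1 ⊙ ∂ (stirling j)) n
      ≡⟨ cong₂ _+_ (cong₂ _+_ (expm1⊙stirling j n) (⊙-identityˡ (stirling j) n))
                   (expm1⊙∂stirling j n) ⟩
    S₂ (suc n) (suc j) + + j * S₂ (suc n) (suc j)
      ≡⟨ x+yx≡[1+y]x (S₂ (suc n) (suc j)) (+ j) ⟩
    + suc j * S₂ (suc n) (suc j) ∎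
    where
    open ≡-Reasoning
    ∂expm1 : ∂ expm1 ≗ expm1 ⊞ 1ˢ
    ∂expm1 zero    = refl
    ∂expm1 (suc n) = refl
    x+yx≡[1+y]x : ∀ (x y : ℤ) → x + y * x ≡ (+ 1 + y) * x
    x+yx≡[1+y]x = solve-∀

  expm1⊙∂stirling : ∀ j → expm1 ⊙ ∂ (stirling j) ≗ (+ j) · ∂ (stirling (suc j))
  expm1⊙∂stirling zero    n = trans (⊙-zeroʳ expm1 n) (sym (ℤ.*-zeroˡ (S₂ (suc n) 1)))
  expm1⊙∂stirling (suc i) n = begin
    (expm1 ⊙ ((+ suc i) · stirling (suc i) ⊞ stirling i)) n
      ≡⟨ ⊙-distribˡ expm1 ((+ suc i) · stirling (suc i)) (stirling i) n ⟩
    (expm1 ⊙ (+ suc i) · stirling (suc i)) n + (expm1 ⊙ stirling i) n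
      ≡⟨ cong₂ _+_ (trans (⊙-· (+ suc i) expm1 (stirling (suc i)) n)
                          (cong (+ suc i *_) (expm1⊙stirling (suc i) n)))
                   (expm1⊙stirling i n) ⟩
    + suc i * (+ suc (suc i) * S₂ n (suc (suc i))) + + suc i * S₂ n (suc i)
      ≡⟨ ℤ.*-distribˡ-+ (+ suc i) (+ suc (suc i) * S₂ n (suc (suc i))) (S₂ n (suc i)) ⟨
    + suc i * S₂ (suc n) (suc (suc i)) ∎
    where open ≡-Reasoning

signedFactorial : ℕ → ℤ
signedFactorial zero    = + 1
signedFactorial (suc k) = - (+ suc k * signedFactorial k)

tˢ : Series
tˢ (suc zero) = + 1
tˢ _          = + 0

-- t = log (1 + (e^t − 1)) = Σₖ (−1)ᵏ k! (e^t − 1)^(k+1) / (k+1)!, read off at tⁿ.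
stirling-log-expansion : ∀ {n N} → n ℕ.< N →
  sumℤ N (λ k → signedFactorial k * S₂ n (suc k)) ≡ tˢ n
stirling-log-expansion {zero}  {N} _   = sumℤ-*-zero N
  where
  sumℤ-*-zero : ∀ N → sumℤ N (λ k → signedFactorial k * + 0) ≡ + 0
  sumℤ-*-zero zero    = refl
  sumℤ-*-zero (suc N) = cong₂ _+_ (sumℤ-*-zero N) (ℤ.*-zeroʳ (signedFactorial N))
stirling-log-expansion {suc m} {N} m<N = begin
  sumℤ N (λ k → signedFactorial k * S₂ (suc m) (suc k))
    ≡⟨ sumℤ-cong N (λ k → telescopic (signedFactorial k) (+ suc k) (S₂ m (suc k)) (S₂ m k)) ⟩
  sumℤ N (λ k → F k - F (suc k))
    ≡⟨ sumℤ-telescope′ N F ⟩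
  F 0 - signedFactorial N * S₂ m N
    ≡⟨ cong (λ x → F 0 - signedFactorial N * x) (S₂-vanish (ℕ.<-trans (ℕ.n<1+n m) m<N)) ⟩
  F 0 - signedFactorial N * + 0
    ≡⟨ cong (_-_ (F 0)) (ℤ.*-zeroʳ (signedFactorial N)) ⟩
  F 0 - + 0
    ≡⟨ leading m ⟩
  tˢ (suc m) ∎
  where
  open ≡-Reasoning
  F : ℕ → ℤ
  F k = signedFactorial k * S₂ m k
  telescopic : ∀ (x y u v : ℤ) → x * (y * u + v) ≡ x * v - (- (y * x)) * u
  telescopic = solve-∀
  leading : ∀ l → signedFactorial 0 * S₂ l 0 - + 0 ≡ tˢ (suc l)
  leading zero    = refl
  leading (suc m) = refl

-- dilate A f is the series f (A t).
dilate : ℤ → Series → Series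
dilate A f n = A ^ n * f n

dilate-⊙ : ∀ A f g → dilate A f ⊙ dilate A g ≗ dilate A (f ⊙ g)
dilate-⊙ A f g zero    =
  trans (cong₂ _*_ (ℤ.*-identityˡ (f 0)) (ℤ.*-identityˡ (g 0))) (sym (ℤ.*-identityˡ (f 0 * g 0)))
dilate-⊙ A f g (suc n) = begin
  (∂ (dilate A f) ⊙ dilate A g) n + (dilate A f ⊙ ∂ (dilate A g)) n
    ≡⟨ cong₂ _+_ (⊙-cong (∂-dilate f) (λ _ → refl) n) (⊙-cong (λ _ → refl) (∂-dilate g) n) ⟩
  (A · dilate A (∂ f) ⊙ dilate A g) n + (dilate A f ⊙ A · dilate A (∂ g)) n
    ≡⟨ cong₂ _+_ (·-⊙ A (dilate A (∂ f)) (dilate A g) n) (⊙-· A (dilate A f) (dilate A (∂ g)) n) ⟩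
  A * (dilate A (∂ f) ⊙ dilate A g) n + A * (dilate A f ⊙ dilate A (∂ g)) n
    ≡⟨ cong₂ _+_ (cong (A *_) (dilate-⊙ A (∂ f) g n)) (cong (A *_) (dilate-⊙ A f (∂ g) n)) ⟩
  A * (A ^ n * (∂ f ⊙ g) n) + A * (A ^ n * (f ⊙ ∂ g) n)
    ≡⟨ factor A (A ^ n) ((∂ f ⊙ g) n) ((f ⊙ ∂ g) n) ⟩
  A * A ^ n * ((∂ f ⊙ g) n + (f ⊙ ∂ g) n) ∎
  where
  open ≡-Reasoning
  ∂-dilate : ∀ h → ∂ (dilate A h) ≗ A · dilate A (∂ h)
  ∂-dilate h m = ℤ.*-assoc A (A ^ m) (h (suc m))
  factor : ∀ (a p x y : ℤ) → a * (p * x) + a * (p * y) ≡ a * p * (x + y)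
  factor = solve-∀

module _ {A : ℤ} {s : Series} (expm1⊙s : expm1 ⊙ s ≗ dilate A expm1) where

  -- (uʲ/j!) sʲ = (u s)ʲ/j! and u s = u (A t), where u = e^t − 1.
  stirling⊙^ˢ : ∀ j → stirling j ⊙ s ^ˢ j ≗ dilate A (stirling j)
  stirling⊙^ˢ zero    n = trans (⊙-identityʳ (stirling 0) n) (stirling-0 n)
    where
    stirling-0 : ∀ n → S₂ n 0 ≡ A ^ n * S₂ n 0
    stirling-0 zero    = refl
    stirling-0 (suc n) = sym (ℤ.*-zeroʳ (A ^ suc n))
  stirling⊙^ˢ (suc i) n = ℤ.*-cancelˡ-≡ (+ suc i) _ _ (begin
    + suc i * (stirling (suc i) ⊙ s ^ˢ suc i) n
      ≡⟨ ·-⊙ (+ suc i) (stirling (suc i)) (s ^ˢ suc i) n ⟨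
    ((+ suc i) · stirling (suc i) ⊙ s ^ˢ suc i) n
      ≡⟨ ⊙-cong (λ m → sym (expm1⊙stirling i m)) (λ _ → refl) n ⟩
    ((expm1 ⊙ stirling i) ⊙ (s ^ˢ i ⊙ s)) n
      ≡⟨ ⊙-rearrange expm1 (stirling i) (s ^ˢ i) s n ⟩
    ((stirling i ⊙ s ^ˢ i) ⊙ (expm1 ⊙ s)) n
      ≡⟨ ⊙-cong (stirling⊙^ˢ i) expm1⊙s n ⟩
    (dilate A (stirling i) ⊙ dilate A expm1) n
      ≡⟨ dilate-⊙ A (stirling i) expm1 n ⟩
    A ^ n * (stirling i ⊙ expm1) n
      ≡⟨ cong (A ^ n *_) (trans (⊙-comm (stirling i) expm1 n) (expm1⊙stirling i n)) ⟩
    A ^ n * (+ suc i * S₂ n (suc i))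
      ≡⟨ swap (A ^ n) (+ suc i) (S₂ n (suc i)) ⟩
    + suc i * (A ^ n * S₂ n (suc i)) ∎)
    where
    open ≡-Reasoning
    swap : ∀ (p x y : ℤ) → p * (x * y) ≡ x * (p * y)
    swap = solve-∀

  At/s-term : ℕ → Series
  At/s-term k = signedFactorial k · (stirling (suc k) ⊙ s ^ˢ k)

  -- At/s-term k = O(t^(k+1)), so only the terms k ≤ n contribute to coefficient n.
  At/s : Series
  At/s n = Σˢ (suc n) At/s-term n

  Σ-At/s-term⊙s : ∀ N → Σˢ N At/s-term ⊙ s ≗
                     λ n → A ^ n * sumℤ N (λ k → signedFactorial k * S₂ n (suc k))
  Σ-At/s-term⊙s N n = begin
    (Σˢ N At/s-term ⊙ s) n
      ≡⟨ ⊙-sumˡ N At/s-term s n ⟩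
    sumℤ N (λ k → (At/s-term k ⊙ s) n)
      ≡⟨ sumℤ-cong N (λ k → trans (·-⊙ (signedFactorial k) _ s n)
                                  (cong (signedFactorial k *_) (stirling⊙^ˢ⊙s k))) ⟩
    sumℤ N (λ k → signedFactorial k * (A ^ n * S₂ n (suc k)))
      ≡⟨ sumℤ-cong N (λ k → swap (signedFactorial k) (A ^ n) (S₂ n (suc k))) ⟩
    sumℤ N (λ k → A ^ n * (signedFactorial k * S₂ n (suc k)))
      ≡⟨ sumℤ-*ˡ N (A ^ n) (λ k → signedFactorial k * S₂ n (suc k)) ⟩
    A ^ n * sumℤ N (λ k → signedFactorial k * S₂ n (suc k)) ∎
    where
    open ≡-Reasoning
    stirling⊙^ˢ⊙s : ∀ k → ((stirling (suc k) ⊙ s ^ˢ k) ⊙ s) n ≡ A ^ n * S₂ n (suc k)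
    stirling⊙^ˢ⊙s k = trans (⊙-assoc (stirling (suc k)) (s ^ˢ k) s n) (stirling⊙^ˢ (suc k) n)
    swap : ∀ (x p y : ℤ) → x * (p * y) ≡ p * (x * y)
    swap = solve-∀

  At/s-term-vanish : ∀ k {n} → n ℕ.< suc k → At/s-term k n ≡ + 0
  At/s-term-vanish k n<k+1 =
    trans (cong (signedFactorial k *_)
                (⊙-vanishes-below (s ^ˢ k) (suc k) (λ _ i<k+1 → S₂-vanish i<k+1) _ n<k+1))
          (ℤ.*-zeroʳ (signedFactorial k))

  Σ-At/s-term-stable : ∀ {N n} → n ℕ.< N → Σˢ N At/s-term n ≡ At/s n
  Σ-At/s-term-stable {suc N} {n} n<N+1 with ℕ.m<1+n⇒m<n∨m≡n n<N+1
  ... | inj₁ n<N    = trans (cong₂ _+_ (Σ-At/s-term-stable n<N)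
                                       (At/s-term-vanish N (ℕ.m<n⇒m<1+n n<N)))
                            (ℤ.+-identityʳ (At/s n))
  ... | inj₂ refl   = refl

  At/s⊙s : At/s ⊙ s ≗ dilate A tˢ
  At/s⊙s n = begin
    (At/s ⊙ s) n
      ≡⟨ ⊙-congˡ-upTo s n (λ i i≤n → sym (Σ-At/s-term-stable (s≤s i≤n))) ⟩
    (Σˢ (suc n) At/s-term ⊙ s) n
      ≡⟨ Σ-At/s-term⊙s (suc n) n ⟩
    A ^ n * sumℤ (suc n) (λ k → signedFactorial k * S₂ n (suc k))
      ≡⟨ cong (A ^ n *_) (stirling-log-expansion (ℕ.n<1+n n)) ⟩
    A ^ n * tˢ n ∎
    where open ≡-Reasoning

expSum : ℕ → Series
expSum a = Σˢ a (λ j → exp (+ j))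

expm1⊙expSum : ∀ a → expm1 ⊙ expSum a ≗ dilate (+ a) expm1
expm1⊙expSum a n = begin
  (expm1 ⊙ expSum a) n
    ≡⟨ ⊙-sumʳ a expm1 (λ j → exp (+ j)) n ⟩
  sumℤ a (λ j → (expm1 ⊙ exp (+ j)) n)
    ≡⟨ sumℤ-cong a (λ j → expm1⊙exp (+ j) n) ⟩
  sumℤ a (λ j → exp (+ suc j) n - exp (+ j) n)
    ≡⟨ sumℤ-telescope a (λ j → exp (+ j) n) ⟩
  exp (+ a) n - exp (+ 0) n
    ≡⟨ cong (_-_ (exp (+ a) n)) (exp-0 n) ⟩
  exp (+ a) n - 1ˢ n
    ≡⟨ constant-term n ⟩
  (+ a) ^ n * expm1 n ∎
  where
  open ≡-Reasoning
  constant-term : ∀ n → exp (+ a) n - 1ˢ n ≡ (+ a) ^ n * expm1 n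
  constant-term zero    = refl
  constant-term (suc n) = trans (ℤ.+-identityʳ ((+ a) ^ suc n)) (sym (ℤ.*-identityʳ ((+ a) ^ suc n)))

⟦_⟧ : ℤ → ℚ
⟦ x ⟧ = x Q./ 1

ι : (d : ℕ) → .{{ℕ.NonZero d}} → ℚ
ι d = + 1 Q./ d

toℚᵘ-/ : ∀ x k → toℚᵘ (x Q./ suc k) ℚᵘ.≃ mkℚᵘ x k
toℚᵘ-/ x k = Q.toℚᵘ-fromℚᵘ (mkℚᵘ x k)

-- Normalisation blocks computation in ℚ, so these identities are checked in ℚᵘ.
≡-via-ℚᵘ : ∀ {p q} r → toℚᵘ p ℚᵘ.≃ r → toℚᵘ q ℚᵘ.≃ r → p ≡ q
≡-via-ℚᵘ r p≃r q≃r = Q.toℚᵘ-injective (ℚᵘ.≃-trans p≃r (ℚᵘ.≃-sym q≃r))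

⟦⟧-+ : ∀ x y → ⟦ x ℤ.+ y ⟧ ≡ ⟦ x ⟧ Q.+ ⟦ y ⟧
⟦⟧-+ x y = ≡-via-ℚᵘ (mkℚᵘ (x ℤ.+ y) 0) (toℚᵘ-/ (x ℤ.+ y) 0)
  (ℚᵘ.≃-trans (Q.toℚᵘ-homo-+ ⟦ x ⟧ ⟦ y ⟧)
  (ℚᵘ.≃-trans (ℚᵘ.+-cong (toℚᵘ-/ x 0) (toℚᵘ-/ y 0)) (*≡* (cross-multiply x y))))
  where
  cross-multiply : ∀ (x y : ℤ) → (x ℤ.* + 1 ℤ.+ y ℤ.* + 1) ℤ.* + 1 ≡ (x ℤ.+ y) ℤ.* + 1
  cross-multiply = solve-∀

⟦⟧-* : ∀ x y → ⟦ x ℤ.* y ⟧ ≡ ⟦ x ⟧ Q.* ⟦ y ⟧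
⟦⟧-* x y = ≡-via-ℚᵘ (mkℚᵘ (x ℤ.* y) 0) (toℚᵘ-/ (x ℤ.* y) 0)
  (ℚᵘ.≃-trans (Q.toℚᵘ-homo-* ⟦ x ⟧ ⟦ y ⟧) (ℚᵘ.≃-trans (ℚᵘ.*-cong (toℚᵘ-/ x 0) (toℚᵘ-/ y 0)) (*≡* refl)))

/-≡-*ι : ∀ x d .{{_ : ℕ.NonZero d}} → x Q./ d ≡ ⟦ x ⟧ Q.* ι d
/-≡-*ι x (suc k) = ≡-via-ℚᵘ (mkℚᵘ x k) (toℚᵘ-/ x k)
  (ℚᵘ.≃-trans (Q.toℚᵘ-homo-* ⟦ x ⟧ (ι (suc k)))
  (ℚᵘ.≃-trans (ℚᵘ.*-cong (toℚᵘ-/ x 0) (toℚᵘ-/ (+ 1) k)) (*≡* (cross-multiply x (+ suc k)))))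
  where
  cross-multiply : ∀ (x d : ℤ) → (x ℤ.* + 1) ℤ.* d ≡ x ℤ.* (+ 1 ℤ.* d)
  cross-multiply = solve-∀

ι-inverseˡ : ∀ d .{{_ : ℕ.NonZero d}} → ι d Q.* ⟦ + d ⟧ ≡ 1ℚ
ι-inverseˡ (suc k) = ≡-via-ℚᵘ (mkℚᵘ (+ 1) 0)
  (ℚᵘ.≃-trans (Q.toℚᵘ-homo-* (ι (suc k)) ⟦ + suc k ⟧)
  (ℚᵘ.≃-trans (ℚᵘ.*-cong (toℚᵘ-/ (+ 1) k) (toℚᵘ-/ (+ suc k) 0)) (*≡* (cross-multiply (+ suc k)))))
  (toℚᵘ-/ (+ 1) 0)
  where
  cross-multiply : ∀ (d : ℤ) → (+ 1 ℤ.* d) ℤ.* + 1 ≡ + 1 ℤ.* (d ℤ.* + 1)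
  cross-multiply = solve-∀

ι-* : ∀ m d .{{_ : ℕ.NonZero m}} .{{_ : ℕ.NonZero d}} →
      ι (m ℕ.* d) {{ℕ.m*n≢0 m d}} ≡ ι m Q.* ι d
ι-* (suc m) (suc d) = ≡-via-ℚᵘ (mkℚᵘ (+ 1) (d ℕ.+ m ℕ.* suc d)) (toℚᵘ-/ (+ 1) (d ℕ.+ m ℕ.* suc d))
  (ℚᵘ.≃-trans (Q.toℚᵘ-homo-* (ι (suc m)) (ι (suc d)))
  (ℚᵘ.≃-trans (ℚᵘ.*-cong (toℚᵘ-/ (+ 1) m) (toℚᵘ-/ (+ 1) d)) (*≡* refl)))

ι! : ℕ → ℚ
ι! n = ι (n !) {{n !≢0}}

*-cancelˡ-invertible : ∀ {r r′ p q} → r′ Q.* r ≡ 1ℚ → r Q.* p ≡ r Q.* q → p ≡ q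
*-cancelˡ-invertible {r} {r′} {p} {q} r′r≡1 rp≡rq = begin
  p                  ≡⟨ Q.*-identityˡ p ⟨
  1ℚ Q.* p           ≡⟨ cong (Q._* p) r′r≡1 ⟨
  r′ Q.* r Q.* p     ≡⟨ Q.*-assoc r′ r p ⟩
  r′ Q.* (r Q.* p)   ≡⟨ cong (r′ Q.*_) rp≡rq ⟩
  r′ Q.* (r Q.* q)   ≡⟨ Q.*-assoc r′ r q ⟨
  r′ Q.* r Q.* q     ≡⟨ cong (Q._* q) r′r≡1 ⟩
  1ℚ Q.* q           ≡⟨ Q.*-identityˡ q ⟩
  q                  ∎
  where open ≡-Reasoning

*-cancelʳ-invertible : ∀ {r r′ p q} → r Q.* r′ ≡ 1ℚ → p Q.* r ≡ q Q.* r → p ≡ q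
*-cancelʳ-invertible {r} {r′} {p} {q} rr′≡1 pr≡qr =
  *-cancelˡ-invertible {r} {r′} (trans (Q.*-comm r′ r) rr′≡1)
    (trans (Q.*-comm r p) (trans pr≡qr (Q.*-comm q r)))

sumBelow-cong : ∀ m {f g : ℕ → ℚ} → (∀ k → k ℕ.< m → f k ≡ g k) → sumBelow m f ≡ sumBelow m g
sumBelow-cong zero    f≡g = refl
sumBelow-cong (suc m) f≡g =
  cong₂ Q._+_ (sumBelow-cong m (λ k k<m → f≡g k (ℕ.m<n⇒m<1+n k<m))) (f≡g m (ℕ.n<1+n m))

sumBelow-+ : ∀ m (f g : ℕ → ℚ) → sumBelow m (λ k → f k Q.+ g k) ≡ sumBelow m f Q.+ sumBelow m g
sumBelow-+ zero    f g = sym (Q.+-identityˡ Q.0ℚ)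
sumBelow-+ (suc m) f g =
  trans (cong (Q._+ (f m Q.+ g m)) (sumBelow-+ m f g))
        (interchange (sumBelow m f) (sumBelow m g) (f m) (g m))
  where
  open +-*-Solver using (solve; _:+_; _:=_)
  interchange : ∀ a b c d → (a Q.+ b) Q.+ (c Q.+ d) ≡ (a Q.+ c) Q.+ (b Q.+ d)
  interchange = solve 4 (λ a b c d → (a :+ b) :+ (c :+ d) := (a :+ c) :+ (b :+ d)) refl

sumBelow-*ˡ : ∀ m x (f : ℕ → ℚ) → sumBelow m (λ k → x Q.* f k) ≡ x Q.* sumBelow m f
sumBelow-*ˡ zero    x f = sym (Q.*-zeroʳ x)
sumBelow-*ˡ (suc m) x f =
  trans (cong (Q._+ x Q.* f m) (sumBelow-*ˡ m x f)) (sym (Q.*-distribˡ-+ x (sumBelow m f) (f m)))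

sumBelow-*ʳ : ∀ m x (f : ℕ → ℚ) → sumBelow m (λ k → f k Q.* x) ≡ sumBelow m f Q.* x
sumBelow-*ʳ m x f =
  trans (sumBelow-cong m (λ k _ → Q.*-comm (f k) x)) (trans (sumBelow-*ˡ m x f) (Q.*-comm x _))

sumBelow-suc : ∀ m (f : ℕ → ℚ) → sumBelow (suc m) f ≡ f 0 Q.+ sumBelow m (f ∘ suc)
sumBelow-suc zero    f = trans (Q.+-identityˡ (f 0)) (sym (Q.+-identityʳ (f 0)))
sumBelow-suc (suc m) f = trans (cong (Q._+ f (suc m)) (sumBelow-suc m f)) (Q.+-assoc (f 0) _ (f (suc m)))

⟦⟧-sumℤ : ∀ m (f : ℕ → ℤ) → ⟦ sumℤ m f ⟧ ≡ sumBelow m (λ k → ⟦ f k ⟧)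
⟦⟧-sumℤ zero    f = refl
⟦⟧-sumℤ (suc m) f = trans (⟦⟧-+ (sumℤ m f) (f m)) (cong (Q._+ ⟦ f m ⟧) (⟦⟧-sumℤ m f))

⊛-congˡ : ∀ {F F′} G → F ≗ F′ → F ⊛ G ≗ F′ ⊛ G
⊛-congˡ G F≗F′ n = sumBelow-cong (suc n) (λ k _ → cong (Q._* G (n ∸ k)) (F≗F′ k))

⊛-congʳ : ∀ F {G G′} → G ≗ G′ → F ⊛ G ≗ F ⊛ G′
⊛-congʳ F G≗G′ n = sumBelow-cong (suc n) (λ k _ → cong (F k Q.*_) (G≗G′ (n ∸ k)))

deriv : PowerSeries → PowerSeries
deriv F k = ⟦ + suc k ⟧ Q.* F (suc k)

⟦⟧-∸-split : ∀ {k n} → k ℕ.≤ n → ⟦ + n ⟧ ≡ ⟦ + k ⟧ Q.+ ⟦ + (n ∸ k) ⟧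
⟦⟧-∸-split {k} {n} k≤n =
  trans (cong (⟦_⟧ ∘ +_) (sym (ℕ.m+[n∸m]≡n k≤n)))
        (trans (cong ⟦_⟧ (ℤ.pos-+ k (n ∸ k))) (⟦⟧-+ (+ k) (+ (n ∸ k))))

⊛-leibniz : ∀ F G n → ⟦ + suc n ⟧ Q.* (F ⊛ G) (suc n) ≡ (deriv F ⊛ G) n Q.+ (F ⊛ deriv G) n
⊛-leibniz F G n = begin
  ⟦ + suc n ⟧ Q.* sumBelow (suc (suc n)) h
    ≡⟨ sumBelow-*ˡ (suc (suc n)) ⟦ + suc n ⟧ h ⟨
  sumBelow (suc (suc n)) (λ k → ⟦ + suc n ⟧ Q.* h k)
    ≡⟨ sumBelow-cong (suc (suc n)) (λ k k<n+2 →
         trans (cong (Q._* h k) (⟦⟧-∸-split (ℕ.≤-pred k<n+2))) (Q.*-distribʳ-+ (h k) ⟦ + k ⟧ _)) ⟩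
  sumBelow (suc (suc n)) (λ k → ⟦ + k ⟧ Q.* h k Q.+ ⟦ + (suc n ∸ k) ⟧ Q.* h k)
    ≡⟨ sumBelow-+ (suc (suc n)) _ _ ⟩
  sumBelow (suc (suc n)) (λ k → ⟦ + k ⟧ Q.* h k) Q.+ sumBelow (suc (suc n)) (λ k → ⟦ + (suc n ∸ k) ⟧ Q.* h k)
    ≡⟨ cong₂ Q._+_ deriv-left deriv-right ⟩
  (deriv F ⊛ G) n Q.+ (F ⊛ deriv G) n ∎
  where
  open ≡-Reasoning
  h : ℕ → ℚ
  h k = F k Q.* G (suc n ∸ k)
  deriv-left : sumBelow (suc (suc n)) (λ k → ⟦ + k ⟧ Q.* h k) ≡ (deriv F ⊛ G) n
  deriv-left = begin
    sumBelow (suc (suc n)) (λ k → ⟦ + k ⟧ Q.* h k)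
      ≡⟨ sumBelow-suc (suc n) (λ k → ⟦ + k ⟧ Q.* h k) ⟩
    ⟦ + 0 ⟧ Q.* h 0 Q.+ sumBelow (suc n) (λ k → ⟦ + suc k ⟧ Q.* h (suc k))
      ≡⟨ cong (Q._+ back) (Q.*-zeroˡ (h 0)) ⟩
    Q.0ℚ Q.+ sumBelow (suc n) (λ k → ⟦ + suc k ⟧ Q.* h (suc k))
      ≡⟨ Q.+-identityˡ back ⟩
    sumBelow (suc n) (λ k → ⟦ + suc k ⟧ Q.* (F (suc k) Q.* G (n ∸ k)))
      ≡⟨ sumBelow-cong (suc n) (λ k _ → Q.*-assoc ⟦ + suc k ⟧ (F (suc k)) (G (n ∸ k))) ⟨
    (deriv F ⊛ G) n ∎
    where
    back : ℚ
    back = sumBelow (suc n) (λ k → ⟦ + suc k ⟧ Q.* h (suc k))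
  deriv-right : sumBelow (suc (suc n)) (λ k → ⟦ + (suc n ∸ k) ⟧ Q.* h k) ≡ (F ⊛ deriv G) n
  deriv-right = begin
    sumBelow (suc n) (λ k → ⟦ + (suc n ∸ k) ⟧ Q.* h k) Q.+ ⟦ + (suc n ∸ suc n) ⟧ Q.* h (suc n)
      ≡⟨ cong (λ m → front Q.+ ⟦ + m ⟧ Q.* h (suc n)) (ℕ.n∸n≡0 n) ⟩
    sumBelow (suc n) (λ k → ⟦ + (suc n ∸ k) ⟧ Q.* h k) Q.+ ⟦ + 0 ⟧ Q.* h (suc n)
      ≡⟨ cong (front Q.+_) (Q.*-zeroˡ (h (suc n))) ⟩
    sumBelow (suc n) (λ k → ⟦ + (suc n ∸ k) ⟧ Q.* h k) Q.+ Q.0ℚ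
      ≡⟨ Q.+-identityʳ front ⟩
    sumBelow (suc n) (λ k → ⟦ + (suc n ∸ k) ⟧ Q.* (F k Q.* G (suc n ∸ k)))
      ≡⟨ sumBelow-cong (suc n) (λ k k<n+1 →
           trans (cong (λ m → ⟦ + m ⟧ Q.* (F k Q.* G m)) (ℕ.+-∸-assoc 1 (ℕ.≤-pred k<n+1)))
                 (swap ⟦ + suc (n ∸ k) ⟧ (F k) (G (suc (n ∸ k))))) ⟩
    (F ⊛ deriv G) n ∎
    where
    front : ℚ
    front = sumBelow (suc n) (λ k → ⟦ + (suc n ∸ k) ⟧ Q.* h k)
    swap : ∀ x a b → x Q.* (a Q.* b) ≡ a Q.* (x Q.* b)
    swap = solve 3 (λ x a b → x :* (a :* b) := a :* (x :* b)) refl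
      where open +-*-Solver using (solve; _:*_; _:=_)

egfℤ : Series → PowerSeries
egfℤ f = egf (⟦_⟧ ∘ f)

egfℤ-cong : ∀ {f g} → f ≗ g → egfℤ f ≗ egfℤ g
egfℤ-cong f≗g k = cong (λ x → ⟦ x ⟧ Q.* ι! k) (f≗g k)

egfℤ-∂ : ∀ f → egfℤ (∂ f) ≗ deriv (egfℤ f)
egfℤ-∂ f k = sym (begin
  ⟦ + suc k ⟧ Q.* (x Q.* ι! (suc k))
    ≡⟨ cong (λ y → ⟦ + suc k ⟧ Q.* (x Q.* y)) (ι-* (suc k) (k !) {{_}} {{k !≢0}}) ⟩
  ⟦ + suc k ⟧ Q.* (x Q.* (ι (suc k) Q.* ι! k))
    ≡⟨ rearrange ⟦ + suc k ⟧ x (ι (suc k)) (ι! k) ⟩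
  x Q.* ι! k Q.* (ι (suc k) Q.* ⟦ + suc k ⟧)
    ≡⟨ cong (x Q.* ι! k Q.*_) (ι-inverseˡ (suc k)) ⟩
  x Q.* ι! k Q.* 1ℚ
    ≡⟨ Q.*-identityʳ _ ⟩
  x Q.* ι! k ∎)
  where
  open ≡-Reasoning
  x : ℚ
  x = ⟦ f (suc k) ⟧
  rearrange : ∀ m z i j → m Q.* (z Q.* (i Q.* j)) ≡ z Q.* j Q.* (i Q.* m)
  rearrange = solve 4 (λ m z i j → m :* (z :* (i :* j)) := z :* j :* (i :* m)) refl
    where open +-*-Solver using (solve; _:*_; _:=_)

egfℤ-⊞ : ∀ f g → egfℤ (f ⊞ g) ≗ egfℤ f ⊕ egfℤ g
egfℤ-⊞ f g k =
  trans (cong (Q._* ι! k) (⟦⟧-+ (f k) (g k))) (Q.*-distribʳ-+ _ ⟦ f k ⟧ ⟦ g k ⟧)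

egfℤ-⊙ : ∀ f g → egfℤ f ⊛ egfℤ g ≗ egfℤ (f ⊙ g)
egfℤ-⊙ f g zero    = trans (Q.+-identityˡ _)
  (trans (rearrange ⟦ f 0 ⟧ ⟦ g 0 ⟧) (cong (Q._* 1ℚ) (sym (⟦⟧-* (f 0) (g 0)))))
  where
  rearrange : ∀ x y → (x Q.* 1ℚ) Q.* (y Q.* 1ℚ) ≡ (x Q.* y) Q.* 1ℚ
  rearrange = solve 2 (λ x y → (x :* con 1ℚ) :* (y :* con 1ℚ) := (x :* y) :* con 1ℚ) refl
    where open +-*-Solver using (solve; _:*_; _:=_; con)
egfℤ-⊙ f g (suc n) = *-cancelˡ-invertible {⟦ + suc n ⟧} {ι (suc n)} (ι-inverseˡ (suc n)) (begin
  ⟦ + suc n ⟧ Q.* (egfℤ f ⊛ egfℤ g) (suc n)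
    ≡⟨ ⊛-leibniz (egfℤ f) (egfℤ g) n ⟩
  (deriv (egfℤ f) ⊛ egfℤ g) n Q.+ (egfℤ f ⊛ deriv (egfℤ g)) n
    ≡⟨ cong₂ Q._+_ (⊛-congˡ (egfℤ g) (λ k → sym (egfℤ-∂ f k)) n)
                   (⊛-congʳ (egfℤ f) (λ k → sym (egfℤ-∂ g k)) n) ⟩
  (egfℤ (∂ f) ⊛ egfℤ g) n Q.+ (egfℤ f ⊛ egfℤ (∂ g)) n
    ≡⟨ cong₂ Q._+_ (egfℤ-⊙ (∂ f) g n) (egfℤ-⊙ f (∂ g) n) ⟩
  egfℤ (∂ f ⊙ g) n Q.+ egfℤ (f ⊙ ∂ g) n
    ≡⟨ egfℤ-⊞ (∂ f ⊙ g) (f ⊙ ∂ g) n ⟨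
  egfℤ (∂ (f ⊙ g)) n
    ≡⟨ egfℤ-∂ (f ⊙ g) n ⟩
  ⟦ + suc n ⟧ Q.* egfℤ (f ⊙ g) (suc n) ∎)
  where open ≡-Reasoning

⊛-cancelʳ : ∀ {E e F F′} → E 0 Q.* e ≡ 1ℚ → F ⊛ E ≗ F′ ⊛ E → F ≗ F′
⊛-cancelʳ {E} {e} {F} {F′} E₀e≡1 FE≗F′E n = agree-below (suc n) n (ℕ.n<1+n n)
  where
  agree-below : ∀ m i → i ℕ.< m → F i ≡ F′ i
  agree-below (suc m) i i<m+1 with ℕ.m<1+n⇒m<n∨m≡n i<m+1
  ... | inj₁ i<m  = agree-below m i i<m
  ... | inj₂ refl = *-cancelʳ-invertible {E 0} {e} E₀e≡1
    (subst (λ j → F i Q.* E j ≡ F′ i Q.* E j) (ℕ.n∸n≡0 i) leading-terms)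
    where
    lower-terms : sumBelow i (λ k → F k Q.* E (i ∸ k)) ≡ sumBelow i (λ k → F′ k Q.* E (i ∸ k))
    lower-terms = sumBelow-cong i (λ k k<i → cong (Q._* E (i ∸ k)) (agree-below i k k<i))
    leading-terms : F i Q.* E (i ∸ i) ≡ F′ i Q.* E (i ∸ i)
    leading-terms = ∙-cancelˡ (sumBelow i (λ k → F′ k Q.* E (i ∸ k))) _ _
      (trans (cong (Q._+ F i Q.* E (i ∸ i)) (sym lower-terms)) (FE≗F′E i))

egf-injective : ∀ {G G′} → egf G ≗ egf G′ → G ≗ G′
egf-injective egfG≗egfG′ n = *-cancelʳ-invertible (ι-inverseˡ (n !) {{n !≢0}}) (egfG≗egfG′ n)

pos-^ : ∀ j n → + (j ℕ.^ n) ≡ (+ j) ℤ.^ n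
pos-^ j zero    = refl
pos-^ j (suc n) = trans (ℤ.pos-* j (j ℕ.^ n)) (cong (+ j ℤ.*_) (pos-^ j n))

expSumSeries≗egfℤ : ∀ a → expSumSeries a ≗ egfℤ (expSum a)
expSumSeries≗egfℤ a n = begin
  sumBelow a (λ j → (+ (j ℕ.^ n) Q./ n !) {{n !≢0}})
    ≡⟨ sumBelow-cong a (λ j _ → trans (/-≡-*ι (+ (j ℕ.^ n)) (n !) {{n !≢0}})
                                      (cong (λ z → ⟦ z ⟧ Q.* ι! n) (pos-^ j n))) ⟩
  sumBelow a (λ j → ⟦ exp (+ j) n ⟧ Q.* ι! n)
    ≡⟨ sumBelow-*ʳ a (ι! n) (λ j → ⟦ exp (+ j) n ⟧) ⟩
  sumBelow a (λ j → ⟦ exp (+ j) n ⟧) Q.* ι! n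
    ≡⟨ cong (Q._* ι! n) (⟦⟧-sumℤ a (λ j → exp (+ j) n)) ⟨
  egfℤ (expSum a) n ∎
  where open ≡-Reasoning

expSumSeries-constant : ∀ a → expSumSeries a 0 ≡ ⟦ + a ⟧
expSumSeries-constant zero    = refl
expSumSeries-constant (suc a) =
  trans (cong (Q._+ 1ℚ) (expSumSeries-constant a))
        (trans (sym (⟦⟧-+ (+ a) (+ 1))) (cong (⟦_⟧ ∘ +_) (ℕ.+-comm a 1)))

atSeries≗egfℤ : ∀ a → atSeries a ≗ egfℤ (dilate (+ a) tˢ)
atSeries≗egfℤ a zero          = refl
atSeries≗egfℤ a (suc zero)    =
  sym (trans (cong (λ z → ⟦ z ⟧ Q.* 1ℚ) (trans (ℤ.*-identityʳ (+ a ℤ.* + 1)) (ℤ.*-identityʳ (+ a))))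
             (Q.*-identityʳ ⟦ + a ⟧))
atSeries≗egfℤ a (suc (suc n)) =
  sym (trans (cong (λ z → ⟦ z ⟧ Q.* ι! (suc (suc n))) (ℤ.*-zeroʳ ((+ a) ℤ.^ suc (suc n))))
             (Q.*-zeroˡ (ι! (suc (suc n)))))

theorem1 : (a : ℕ) → 2 ≤ a → (G : ℕ → ℚ) → IsGenocchiSeq a G →
    (n : ℕ) → 1 ≤ n → IsInteger (G n)
-- G₀ = 0 is an integer too, and of 2 ≤ a only a ≠ 0 is needed.
theorem1 a@(suc _) _ G genocchi n _ = g n , egf-injective {G} {⟦_⟧ ∘ g} (⊛-cancelʳ {E} {ι a} E₀-invertible same-product) n
  where
  open ≡-Reasoning
  s : Series
  s = expSum a
  g : Series
  g = At/s (expm1⊙expSum a)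
  E : PowerSeries
  E = expSumSeries a
  E₀-invertible : E 0 Q.* ι a ≡ 1ℚ
  E₀-invertible =
    trans (cong (Q._* ι a) (expSumSeries-constant a)) (trans (Q.*-comm ⟦ + a ⟧ (ι a)) (ι-inverseˡ a))
  same-product : egf G ⊛ E ≗ egfℤ g ⊛ E
  same-product n = begin
    (egf G ⊛ E) n             ≡⟨ genocchi n ⟨
    atSeries a n              ≡⟨ atSeries≗egfℤ a n ⟩
    egfℤ (dilate (+ a) tˢ) n  ≡⟨ egfℤ-cong (At/s⊙s (expm1⊙expSum a)) n ⟨
    egfℤ (g ⊙ s) n            ≡⟨ egfℤ-⊙ g s n ⟨
    (egfℤ g ⊛ egfℤ s) n       ≡⟨ ⊛-congʳ (egfℤ g) (expSumSeries≗egfℤ a) n ⟨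
    (egfℤ g ⊛ E) n            ∎
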